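{- Given types $C_1,\dots,C_k$ and a permutation $\varphi$ of $\{1,\dots,k\}$, we have $[[C_1,\dots,C_k]]\le^a[[C_{\varphi(1)},\dots,C_{\varphi(k)}]]$.
   Context: Simply typed $\lambda$-calculus over base type $0$; every type is uniquely $[A_1,\dots,A_n]:=A_1\to\cdots\to A_n\to0$ (so $[[C_1,\dots,C_k]]=(C_1\to\cdots\to C_k\to0)\to0$). A context is a finite list of distinct typed variables, $\{\Gamma\}$ its set; terms identified up to $\beta\eta$ ($=_{\beta\eta}$); $\Lambda^\Xi(A)$ = terms of type $A$ with free variables in $\{\Xi\}$. A substitution $\varrho$ from $\Gamma$ to $\Delta$ assigns $\varrho_c\in\Lambda^\Delta(C)$ to each $c^C\in\{\Gamma\}$; for a fresh context $\Xi$, $\varrho^\Xi$ is $\varrho$ on $\{\Gamma\}$ and the identity on $\{\Xi\}$. $\varrho$ is an atomic reduction if for every fresh $\Xi$, all $a^A,b^B\in\{\Xi,\Gamma\}$ with $A\equiv[A_1,\dots,A_n]$, $B\equiv[B_1,\dots,B_m]$, and all $M_i\in\Lambda^{\Xi,\Delta}(A_i)$, $N_i\in\Lambda^{\Xi,\Delta}(B_i)$: $\varrho^\Xi_aM_1\cdots M_n=_{\beta\eta}\varrho^\Xi_bN_1\cdots N_m$ implies $a=b$ and all $M_i=N_i$. For types, $[\Gamma]\le^a[\Delta]$ means there is an atomic reduction from the context $\Gamma$ to the context $\Delta$ (for $\Gamma=x_1^{C_1},\dots,x_k^{C_k}$, $[\Gamma]:=[C_1,\dots,C_k]$). -}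

module Defs where

open import Data.List using (List; []; _∷_; _++_)
open import Data.Product using (Σ)

infixr 7 _⇒_
data Ty : Set where
  ι   : Ty
  _⇒_ : Ty → Ty → Ty

[_] : List Ty → Ty
[ [] ]     = ι
[ A ∷ As ] = A ⇒ [ As ]

args : Ty → List Ty
args ι       = []
args (A ⇒ B) = A ∷ args B

Ctx : Set
Ctx = List Ty

infix 4 _∋_
data _∋_ : Ctx → Ty → Set where
  Z  : ∀ {Γ A} → A ∷ Γ ∋ A
  S_ : ∀ {Γ A B} → Γ ∋ A → B ∷ Γ ∋ A

data Tm (Γ : Ctx) : Ty → Set where
  var : ∀ {A} → Γ ∋ A → Tm Γ A
  lam : ∀ {A B} → Tm (A ∷ Γ) B → Tm Γ (A ⇒ B)
  app : ∀ {A B} → Tm Γ (A ⇒ B) → Tm Γ A → Tm Γ B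

Ren : Ctx → Ctx → Set
Ren Γ Δ = ∀ {A} → Γ ∋ A → Δ ∋ A

ext : ∀ {Γ Δ B} → Ren Γ Δ → Ren (B ∷ Γ) (B ∷ Δ)
ext ρ Z     = Z
ext ρ (S x) = S (ρ x)

rename : ∀ {Γ Δ A} → Ren Γ Δ → Tm Γ A → Tm Δ A
rename ρ (var x)   = var (ρ x)
rename ρ (lam M)   = lam (rename (ext ρ) M)
rename ρ (app M N) = app (rename ρ M) (rename ρ N)

Sub : Ctx → Ctx → Set
Sub Γ Δ = ∀ {C} → Γ ∋ C → Tm Δ C

exts : ∀ {Γ Δ B} → Sub Γ Δ → Sub (B ∷ Γ) (B ∷ Δ)
exts σ Z     = var Z
exts σ (S x) = rename S_ (σ x)

sub : ∀ {Γ Δ A} → Sub Γ Δ → Tm Γ A → Tm Δ A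
sub σ (var x)   = σ x
sub σ (lam M)   = lam (sub (exts σ) M)
sub σ (app M N) = app (sub σ M) (sub σ N)

sub₀ : ∀ {Γ A} → Tm Γ A → Sub (A ∷ Γ) Γ
sub₀ N Z     = N
sub₀ N (S x) = var x

_[_]₀ : ∀ {Γ A B} → Tm (A ∷ Γ) B → Tm Γ A → Tm Γ B
M [ N ]₀ = sub (sub₀ N) M

infix 4 _=βη_
data _=βη_ {Γ : Ctx} : ∀ {A} → Tm Γ A → Tm Γ A → Set where
  β     : ∀ {A B} (M : Tm (A ∷ Γ) B) (N : Tm Γ A) → app (lam M) N =βη M [ N ]₀
  η     : ∀ {A B} (M : Tm Γ (A ⇒ B)) → M =βη lam (app (rename S_ M) (var Z))
  ξ-lam : ∀ {A B} {M M′ : Tm (A ∷ Γ) B} → M =βη M′ → lam M =βη lam M′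
  ξ-app : ∀ {A B} {M M′ : Tm Γ (A ⇒ B)} {N N′ : Tm Γ A} →
          M =βη M′ → N =βη N′ → app M N =βη app M′ N′
  refl  : ∀ {A} {M : Tm Γ A} → M =βη M
  sym   : ∀ {A} {M N : Tm Γ A} → M =βη N → N =βη M
  trans : ∀ {A} {M N P : Tm Γ A} → M =βη N → N =βη P → M =βη P

-- Argument lists M₁,…,Mₙ for a head of type A ≡ [A₁,…,Aₙ], Mᵢ : Aᵢ.
data Spine (Γ : Ctx) : Ty → Set where
  []  : Spine Γ ι
  _∷_ : ∀ {A B} → Tm Γ A → Spine Γ B → Spine Γ (A ⇒ B)

apps : ∀ {Γ A} → Tm Γ A → Spine Γ A → Tm Γ ι
apps M []       = M
apps M (N ∷ Ns) = apps (app M N) Ns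

data _≈ₛ_ {Γ : Ctx} : ∀ {A} → Spine Γ A → Spine Γ A → Set where
  []  : [] ≈ₛ []
  _∷_ : ∀ {A B} {M N : Tm Γ A} {Ms Ns : Spine Γ B} →
        M =βη N → Ms ≈ₛ Ns → (M ∷ Ms) ≈ₛ (N ∷ Ns)

lift : ∀ {Γ Δ} (Ξ : Ctx) → Sub Γ Δ → Sub (Ξ ++ Γ) (Ξ ++ Δ)
lift []      ϱ = ϱ
lift (A ∷ Ξ) ϱ = exts (lift Ξ ϱ)

-- "a = b and Mᵢ = Nᵢ for all i" (forces the types of a and b to agree).
data SameHeadArgs {Θ Φ : Ctx} : ∀ {A B} → Θ ∋ A → Θ ∋ B →
                   Spine Φ A → Spine Φ B → Set where
  same : ∀ {A} {a : Θ ∋ A} {Ms Ns : Spine Φ A} →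
         Ms ≈ₛ Ns → SameHeadArgs a a Ms Ns

IsAtomicReduction : ∀ {Γ Δ} → Sub Γ Δ → Set
IsAtomicReduction {Γ} {Δ} ϱ =
  ∀ (Ξ : Ctx) {A B} (a : Ξ ++ Γ ∋ A) (b : Ξ ++ Γ ∋ B)
    (Ms : Spine (Ξ ++ Δ) A) (Ns : Spine (Ξ ++ Δ) B) →
    apps (lift Ξ ϱ a) Ms =βη apps (lift Ξ ϱ b) Ns →
    SameHeadArgs a b Ms Ns

-- Atomic reduction between contexts, and the induced relation on types:
-- A ≤ᵃ B iff there is an atomic reduction from Γ to Δ where [Γ] = A, [Δ] = B
-- (Γ, Δ are unique up to naming: Γ = args A, Δ = args B).
_≤ᵃᶜ_ : Ctx → Ctx → Set
Γ ≤ᵃᶜ Δ = Σ (Sub Γ Δ) IsAtomicReduction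

infix 4 _≤ᵃ_
_≤ᵃ_ : Ty → Ty → Set
A ≤ᵃ B = args A ≤ᵃᶜ args B

-- The reduction sends x : [[C₁,…,C_k]] to λ c₁ … c_k. y c_φ(1) … c_φ(k). Under ϱ^Ξ every head applied
-- to arguments then β-reduces to a variable applied to the same arguments, permuted when the head is x.
-- Atomicity therefore comes down to one fact: a variable applied to arguments determines, up to βη, its
-- head and its arguments. This holds because normalisation by evaluation is complete (βη-equal terms
-- have the same normal form, via a PER model) and sound (M =βη ⌜ nf M ⌝, via a logical relation), and
-- the normal form of a ⋯ Mₙ is a applied to the normal forms of the Mᵢ.
module Submission where

open import Defs
open import Data.Nat using (ℕ; zero; suc)
open import Data.Fin using (Fin; zero; suc)
open import Data.List using (List; []; _∷_; _++_; tabulate)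
open import Data.Fin.Permutation using (Permutation′; _⟨$⟩ʳ_; _⟨$⟩ˡ_; inverseʳ)
open import Data.Product using (_×_; _,_; proj₁; proj₂)
open import Data.Empty using (⊥-elim)
open import Relation.Nullary using (¬_)
open import Function using (id; _∘_)
open import Relation.Binary.PropositionalEquality as ≡ using (_≡_; cong; cong₂)

infix 4 _≗ᴿ_ _≗ˢ_

_≗ᴿ_ : ∀ {Γ Δ} → Ren Γ Δ → Ren Γ Δ → Set
ρ ≗ᴿ ρ′ = ∀ {A} (x : _ ∋ A) → ρ x ≡ ρ′ x

_≗ˢ_ : ∀ {Γ Δ} → Sub Γ Δ → Sub Γ Δ → Set
σ ≗ˢ σ′ = ∀ {A} (x : _ ∋ A) → σ x ≡ σ′ x

ext-cong : ∀ {Γ Δ B} {ρ ρ′ : Ren Γ Δ} → ρ ≗ᴿ ρ′ → ext {B = B} ρ ≗ᴿ ext ρ′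
ext-cong h Z     = ≡.refl
ext-cong h (S x) = cong S_ (h x)

rename-cong : ∀ {Γ Δ A} {ρ ρ′ : Ren Γ Δ} → ρ ≗ᴿ ρ′ → (M : Tm Γ A) → rename ρ M ≡ rename ρ′ M
rename-cong h (var x)   = cong var (h x)
rename-cong h (lam M)   = cong lam (rename-cong (ext-cong h) M)
rename-cong h (app M N) = cong₂ app (rename-cong h M) (rename-cong h N)

rename-∘ : ∀ {Γ Δ Θ A} (ρ : Ren Δ Θ) (ρ′ : Ren Γ Δ) (M : Tm Γ A) →
           rename ρ (rename ρ′ M) ≡ rename (ρ ∘ ρ′) M
rename-∘ ρ ρ′ (var x)   = ≡.refl
rename-∘ ρ ρ′ (lam M)   = cong lam (≡.trans (rename-∘ (ext ρ) (ext ρ′) M)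
                                            (rename-cong (λ { Z → ≡.refl ; (S x) → ≡.refl }) M))
rename-∘ ρ ρ′ (app M N) = cong₂ app (rename-∘ ρ ρ′ M) (rename-∘ ρ ρ′ N)

rename-id : ∀ {Γ A} (M : Tm Γ A) → rename id M ≡ M
rename-id (var x)   = ≡.refl
rename-id (lam M)   = cong lam (≡.trans (rename-cong (λ { Z → ≡.refl ; (S x) → ≡.refl }) M) (rename-id M))
rename-id (app M N) = cong₂ app (rename-id M) (rename-id N)

exts-cong : ∀ {Γ Δ B} {σ σ′ : Sub Γ Δ} → σ ≗ˢ σ′ → exts {B = B} σ ≗ˢ exts σ′
exts-cong h Z     = ≡.refl
exts-cong h (S x) = cong (rename S_) (h x)

sub-cong : ∀ {Γ Δ A} {σ σ′ : Sub Γ Δ} → σ ≗ˢ σ′ → (M : Tm Γ A) → sub σ M ≡ sub σ′ M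
sub-cong h (var x)   = h x
sub-cong h (lam M)   = cong lam (sub-cong (exts-cong h) M)
sub-cong h (app M N) = cong₂ app (sub-cong h M) (sub-cong h N)

rename-sub : ∀ {Γ Δ Θ A} (ρ : Ren Δ Θ) (σ : Sub Γ Δ) (M : Tm Γ A) →
             rename ρ (sub σ M) ≡ sub (rename ρ ∘ σ) M
rename-sub ρ σ (var x)   = ≡.refl
rename-sub ρ σ (lam M)   = cong lam (≡.trans (rename-sub (ext ρ) (exts σ) M) (sub-cong ext-exts M))
  where
  ext-exts : rename (ext ρ) ∘ exts σ ≗ˢ exts (rename ρ ∘ σ)
  ext-exts Z     = ≡.refl
  ext-exts (S x) = ≡.trans (rename-∘ (ext ρ) S_ (σ x)) (≡.sym (rename-∘ S_ ρ (σ x)))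
rename-sub ρ σ (app M N) = cong₂ app (rename-sub ρ σ M) (rename-sub ρ σ N)

sub-rename : ∀ {Γ Δ Θ A} (σ : Sub Δ Θ) (ρ : Ren Γ Δ) (M : Tm Γ A) →
             sub σ (rename ρ M) ≡ sub (σ ∘ ρ) M
sub-rename σ ρ (var x)   = ≡.refl
sub-rename σ ρ (lam M)   = cong lam (≡.trans (sub-rename (exts σ) (ext ρ) M)
                                              (sub-cong (λ { Z → ≡.refl ; (S x) → ≡.refl }) M))
sub-rename σ ρ (app M N) = cong₂ app (sub-rename σ ρ M) (sub-rename σ ρ N)

sub-var : ∀ {Γ A} (M : Tm Γ A) → sub var M ≡ M
sub-var (var x)   = ≡.refl
sub-var (lam M)   = cong lam (≡.trans (sub-cong (λ { Z → ≡.refl ; (S x) → ≡.refl }) M) (sub-var M))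
sub-var (app M N) = cong₂ app (sub-var M) (sub-var N)

rename≗sub : ∀ {Γ Δ A} (ρ : Ren Γ Δ) (M : Tm Γ A) → rename ρ M ≡ sub (var ∘ ρ) M
rename≗sub ρ M = ≡.trans (cong (rename ρ) (≡.sym (sub-var M))) (rename-sub ρ var M)

sub-∘ : ∀ {Γ Δ Θ A} (σ : Sub Δ Θ) (τ : Sub Γ Δ) (M : Tm Γ A) →
        sub σ (sub τ M) ≡ sub (sub σ ∘ τ) M
sub-∘ σ τ (var x)   = ≡.refl
sub-∘ σ τ (lam M)   = cong lam (≡.trans (sub-∘ (exts σ) (exts τ) M) (sub-cong exts-exts M))
  where
  exts-exts : sub (exts σ) ∘ exts τ ≗ˢ exts (sub σ ∘ τ)
  exts-exts Z     = ≡.refl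
  exts-exts (S x) = ≡.trans (sub-rename (exts σ) S_ (τ x)) (≡.sym (rename-sub S_ σ (τ x)))
sub-∘ σ τ (app M N) = cong₂ app (sub-∘ σ τ M) (sub-∘ σ τ N)

infixr 5 _▸_
_▸_ : ∀ {Γ Δ A} → Tm Δ A → Sub Γ Δ → Sub (A ∷ Γ) Δ
(N ▸ σ) Z     = N
(N ▸ σ) (S x) = σ x

≡⇒=βη : ∀ {Γ A} {M N : Tm Γ A} → M ≡ N → M =βη N
≡⇒=βη ≡.refl = refl

rename-=βη : ∀ {Γ Δ A} (ρ : Ren Γ Δ) {M N : Tm Γ A} → M =βη N → rename ρ M =βη rename ρ N
rename-=βη ρ (β M N)     = trans (β (rename (ext ρ) M) (rename ρ N)) (≡⇒=βη (≡.trans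
  (sub-rename (sub₀ (rename ρ N)) (ext ρ) M)
  (≡.trans (sub-cong (λ { Z → ≡.refl ; (S x) → ≡.refl }) M) (≡.sym (rename-sub ρ (sub₀ N) M)))))
rename-=βη ρ (η M)       = trans (η (rename ρ M)) (≡⇒=βη (cong (λ t → lam (app t (var Z)))
  (≡.trans (rename-∘ S_ ρ M) (≡.sym (rename-∘ (ext ρ) S_ M)))))
rename-=βη ρ (ξ-lam p)   = ξ-lam (rename-=βη (ext ρ) p)
rename-=βη ρ (ξ-app p q) = ξ-app (rename-=βη ρ p) (rename-=βη ρ q)
rename-=βη ρ refl        = refl
rename-=βη ρ (sym p)     = sym (rename-=βη ρ p)
rename-=βη ρ (trans p q) = trans (rename-=βη ρ p) (rename-=βη ρ q)

apps-congˡ : ∀ {Γ A} {M M′ : Tm Γ A} (Ms : Spine Γ A) → M =βη M′ → apps M Ms =βη apps M′ Ms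
apps-congˡ []       p = p
apps-congˡ (N ∷ Ms) p = apps-congˡ Ms (ξ-app p refl)

mutual
  data Nf (Γ : Ctx) : Ty → Set where
    lamₙ : ∀ {A B} → Nf (A ∷ Γ) B → Nf Γ (A ⇒ B)
    neₙ  : Ne Γ ι → Nf Γ ι

  data Ne (Γ : Ctx) : Ty → Set where
    neu : ∀ {A C} → Γ ∋ A → NeSpine Γ A C → Ne Γ C

  data NeSpine (Γ : Ctx) (A : Ty) : Ty → Set where
    ε   : NeSpine Γ A A
    _▷_ : ∀ {B C} → NeSpine Γ A (B ⇒ C) → Nf Γ B → NeSpine Γ A C

mutual
  renameNf : ∀ {Γ Δ A} → Ren Γ Δ → Nf Γ A → Nf Δ A
  renameNf ρ (lamₙ n) = lamₙ (renameNf (ext ρ) n)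
  renameNf ρ (neₙ n)  = neₙ (renameNe ρ n)

  renameNe : ∀ {Γ Δ A} → Ren Γ Δ → Ne Γ A → Ne Δ A
  renameNe ρ (neu x sp) = neu (ρ x) (renameNeSpine ρ sp)

  renameNeSpine : ∀ {Γ Δ A C} → Ren Γ Δ → NeSpine Γ A C → NeSpine Δ A C
  renameNeSpine ρ ε        = ε
  renameNeSpine ρ (sp ▷ n) = renameNeSpine ρ sp ▷ renameNf ρ n

mutual
  renameNf-cong : ∀ {Γ Δ A} {ρ ρ′ : Ren Γ Δ} → ρ ≗ᴿ ρ′ → (n : Nf Γ A) → renameNf ρ n ≡ renameNf ρ′ n
  renameNf-cong h (lamₙ n) = cong lamₙ (renameNf-cong (ext-cong h) n)
  renameNf-cong h (neₙ n)  = cong neₙ (renameNe-cong h n)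

  renameNe-cong : ∀ {Γ Δ A} {ρ ρ′ : Ren Γ Δ} → ρ ≗ᴿ ρ′ → (n : Ne Γ A) → renameNe ρ n ≡ renameNe ρ′ n
  renameNe-cong h (neu x sp) = cong₂ neu (h x) (renameNeSpine-cong h sp)

  renameNeSpine-cong : ∀ {Γ Δ A C} {ρ ρ′ : Ren Γ Δ} → ρ ≗ᴿ ρ′ → (sp : NeSpine Γ A C) →
                       renameNeSpine ρ sp ≡ renameNeSpine ρ′ sp
  renameNeSpine-cong h ε        = ≡.refl
  renameNeSpine-cong h (sp ▷ n) = cong₂ _▷_ (renameNeSpine-cong h sp) (renameNf-cong h n)

mutual
  renameNf-∘ : ∀ {Γ Δ Θ A} (ρ : Ren Δ Θ) (ρ′ : Ren Γ Δ) (n : Nf Γ A) →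
               renameNf ρ (renameNf ρ′ n) ≡ renameNf (ρ ∘ ρ′) n
  renameNf-∘ ρ ρ′ (lamₙ n) = cong lamₙ (≡.trans (renameNf-∘ (ext ρ) (ext ρ′) n)
                                                (renameNf-cong (λ { Z → ≡.refl ; (S x) → ≡.refl }) n))
  renameNf-∘ ρ ρ′ (neₙ n)  = cong neₙ (renameNe-∘ ρ ρ′ n)

  renameNe-∘ : ∀ {Γ Δ Θ A} (ρ : Ren Δ Θ) (ρ′ : Ren Γ Δ) (n : Ne Γ A) →
               renameNe ρ (renameNe ρ′ n) ≡ renameNe (ρ ∘ ρ′) n
  renameNe-∘ ρ ρ′ (neu x sp) = cong (neu _) (renameNeSpine-∘ ρ ρ′ sp)

  renameNeSpine-∘ : ∀ {Γ Δ Θ A C} (ρ : Ren Δ Θ) (ρ′ : Ren Γ Δ) (sp : NeSpine Γ A C) →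
                    renameNeSpine ρ (renameNeSpine ρ′ sp) ≡ renameNeSpine (ρ ∘ ρ′) sp
  renameNeSpine-∘ ρ ρ′ ε        = ≡.refl
  renameNeSpine-∘ ρ ρ′ (sp ▷ n) = cong₂ _▷_ (renameNeSpine-∘ ρ ρ′ sp) (renameNf-∘ ρ ρ′ n)

mutual
  renameNf-id : ∀ {Γ A} (n : Nf Γ A) → renameNf id n ≡ n
  renameNf-id (lamₙ n) = cong lamₙ (≡.trans (renameNf-cong (λ { Z → ≡.refl ; (S x) → ≡.refl }) n)
                                            (renameNf-id n))
  renameNf-id (neₙ n)  = cong neₙ (renameNe-id n)

  renameNe-id : ∀ {Γ A} (n : Ne Γ A) → renameNe id n ≡ n
  renameNe-id (neu x sp) = cong (neu x) (renameNeSpine-id sp)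

  renameNeSpine-id : ∀ {Γ A C} (sp : NeSpine Γ A C) → renameNeSpine id sp ≡ sp
  renameNeSpine-id ε        = ≡.refl
  renameNeSpine-id (sp ▷ n) = cong₂ _▷_ (renameNeSpine-id sp) (renameNf-id n)

mutual
  ⌜_⌝ : ∀ {Γ A} → Nf Γ A → Tm Γ A
  ⌜ lamₙ n ⌝ = lam ⌜ n ⌝
  ⌜ neₙ n ⌝  = ⌜ n ⌝ⁿᵉ

  ⌜_⌝ⁿᵉ : ∀ {Γ A} → Ne Γ A → Tm Γ A
  ⌜ neu x sp ⌝ⁿᵉ = ⌜ sp ⌝ˢᵖ (var x)

  ⌜_⌝ˢᵖ : ∀ {Γ A C} → NeSpine Γ A C → Tm Γ A → Tm Γ C
  ⌜ ε ⌝ˢᵖ      h = h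
  ⌜ sp ▷ n ⌝ˢᵖ h = app (⌜ sp ⌝ˢᵖ h) ⌜ n ⌝

mutual
  ⌜⌝-rename : ∀ {Γ Δ A} (ρ : Ren Γ Δ) (n : Nf Γ A) → ⌜ renameNf ρ n ⌝ ≡ rename ρ ⌜ n ⌝
  ⌜⌝-rename ρ (lamₙ n) = cong lam (⌜⌝-rename (ext ρ) n)
  ⌜⌝-rename ρ (neₙ n)  = ⌜⌝ⁿᵉ-rename ρ n

  ⌜⌝ⁿᵉ-rename : ∀ {Γ Δ A} (ρ : Ren Γ Δ) (n : Ne Γ A) → ⌜ renameNe ρ n ⌝ⁿᵉ ≡ rename ρ ⌜ n ⌝ⁿᵉ
  ⌜⌝ⁿᵉ-rename ρ (neu x sp) = ⌜⌝ˢᵖ-rename ρ sp (var x)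

  ⌜⌝ˢᵖ-rename : ∀ {Γ Δ A C} (ρ : Ren Γ Δ) (sp : NeSpine Γ A C) (h : Tm Γ A) →
                ⌜ renameNeSpine ρ sp ⌝ˢᵖ (rename ρ h) ≡ rename ρ (⌜ sp ⌝ˢᵖ h)
  ⌜⌝ˢᵖ-rename ρ ε        h = ≡.refl
  ⌜⌝ˢᵖ-rename ρ (sp ▷ n) h = cong₂ app (⌜⌝ˢᵖ-rename ρ sp h) (⌜⌝-rename ρ n)

appNe : ∀ {Γ A B} → Ne Γ (A ⇒ B) → Nf Γ A → Ne Γ B
appNe (neu x sp) n = neu x (sp ▷ n)

renameNe-appNe : ∀ {Γ Δ A B} (ρ : Ren Γ Δ) (m : Ne Γ (A ⇒ B)) (n : Nf Γ A) →
                 renameNe ρ (appNe m n) ≡ appNe (renameNe ρ m) (renameNf ρ n)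
renameNe-appNe ρ (neu x sp) n = ≡.refl

⌜appNe⌝ : ∀ {Γ A B} (m : Ne Γ (A ⇒ B)) (n : Nf Γ A) → ⌜ appNe m n ⌝ⁿᵉ ≡ app ⌜ m ⌝ⁿᵉ ⌜ n ⌝
⌜appNe⌝ (neu x sp) n = ≡.refl

-- Normalisation by evaluation into the Kripke model over renamings.
Val : Ctx → Ty → Set
Val Γ ι       = Nf Γ ι
Val Γ (A ⇒ B) = ∀ {Δ} → Ren Γ Δ → Val Δ A → Val Δ B

renameVal : ∀ {Γ Δ} A → Ren Γ Δ → Val Γ A → Val Δ A
renameVal ι       ρ n = renameNf ρ n
renameVal (A ⇒ B) ρ f = λ ρ′ → f (ρ′ ∘ ρ)

mutual
  reflect : ∀ {Γ} A → Ne Γ A → Val Γ A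
  reflect ι       n = neₙ n
  reflect (A ⇒ B) n = λ ρ v → reflect B (appNe (renameNe ρ n) (reify A v))

  reify : ∀ {Γ} A → Val Γ A → Nf Γ A
  reify ι       n = n
  reify (A ⇒ B) f = lamₙ (reify B (f S_ (reflect A (neu Z ε))))

Env : Ctx → Ctx → Set
Env Γ Δ = ∀ {A} → Γ ∋ A → Val Δ A

extEnv : ∀ {Γ Δ A} → Env Γ Δ → Val Δ A → Env (A ∷ Γ) Δ
extEnv γ v Z     = v
extEnv γ v (S x) = γ x

renameEnv : ∀ {Γ Δ Θ} → Ren Δ Θ → Env Γ Δ → Env Γ Θ
renameEnv ρ γ {C} x = renameVal C ρ (γ x)

eval : ∀ {Γ Δ A} → Tm Γ A → Env Γ Δ → Val Δ A
eval (var x)   γ = γ x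
eval (lam M)   γ = λ ρ v → eval M (extEnv (renameEnv ρ γ) v)
eval (app M N) γ = eval M γ id (eval N γ)

idEnv : ∀ {Γ} → Env Γ Γ
idEnv {A = A} x = reflect A (neu x ε)

nf : ∀ {Γ A} → Tm Γ A → Nf Γ A
nf {A = A} M = reify A (eval M idEnv)

-- The partial equivalence relation on values: extensional and, at function types, natural in renamings.
mutual
  Eq : ∀ {Γ} A → Val Γ A → Val Γ A → Set
  Eq ι       u v = u ≡ v
  Eq (A ⇒ B) f g = (∀ {Δ} (ρ : Ren _ Δ) {u v} → Eq A u v → Eq B (f ρ u) (g ρ v))
                   × Uniform A B f × Uniform A B g

  Uniform : ∀ {Γ} A B → Val Γ (A ⇒ B) → Set
  Uniform A B f = ∀ {Δ Δ′} (ρ : Ren _ Δ) (ρ′ : Ren Δ Δ′) {u} → Eq A u u →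
                  Eq B (renameVal B ρ′ (f ρ u)) (f (ρ′ ∘ ρ) (renameVal A ρ′ u))

Eq-sym : ∀ {Γ} A {u v : Val Γ A} → Eq A u v → Eq A v u
Eq-sym ι       e            = ≡.sym e
Eq-sym (A ⇒ B) (F , Uf , Ug) = (λ ρ e → Eq-sym B (F ρ (Eq-sym A e))) , Ug , Uf

Eq-trans : ∀ {Γ} A {u v w : Val Γ A} → Eq A u v → Eq A v w → Eq A u w
Eq-trans ι       e            e′           = ≡.trans e e′
Eq-trans (A ⇒ B) (F , Uf , _) (G , _ , Uh) =
  (λ ρ e → Eq-trans B (F ρ e) (G ρ (Eq-trans A (Eq-sym A e) e))) , Uf , Uh

Eq-reflˡ : ∀ {Γ} A {u v : Val Γ A} → Eq A u v → Eq A u u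
Eq-reflˡ A e = Eq-trans A e (Eq-sym A e)

Eq-reflʳ : ∀ {Γ} A {u v : Val Γ A} → Eq A u v → Eq A v v
Eq-reflʳ A e = Eq-trans A (Eq-sym A e) e

uniformˡ : ∀ {Γ} A B {f g : Val Γ (A ⇒ B)} → Eq (A ⇒ B) f g → Uniform A B f
uniformˡ A B (_ , Uf , _) = Uf

Eq-renameVal : ∀ {Γ Δ} A (ρ : Ren Γ Δ) {u v : Val Γ A} → Eq A u v →
               Eq A (renameVal A ρ u) (renameVal A ρ v)
Eq-renameVal ι       ρ e             = cong (renameNf ρ) e
Eq-renameVal (A ⇒ B) ρ (F , Uf , Ug) =
  (λ ρ′ → F (ρ′ ∘ ρ)) , (λ ρ′ → Uf (ρ′ ∘ ρ)) , (λ ρ′ → Ug (ρ′ ∘ ρ))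

renameVal-id : ∀ {Γ} A {u : Val Γ A} → Eq A u u → Eq A (renameVal A id u) u
renameVal-id ι       {u} e = renameNf-id u
renameVal-id (A ⇒ B)     e = e

renameVal-∘ : ∀ {Γ Δ Θ} A (ρ : Ren Δ Θ) (ρ′ : Ren Γ Δ) {u : Val Γ A} → Eq A u u →
              Eq A (renameVal A ρ (renameVal A ρ′ u)) (renameVal A (ρ ∘ ρ′) u)
renameVal-∘ ι       ρ ρ′ {u} e = renameNf-∘ ρ ρ′ u
renameVal-∘ (A ⇒ B) ρ ρ′     e = Eq-renameVal (A ⇒ B) (ρ ∘ ρ′) e

mutual
  reify-Eq : ∀ {Γ} A {u v : Val Γ A} → Eq A u v → reify A u ≡ reify A v
  reify-Eq ι       e           = e
  reify-Eq (A ⇒ B) (F , _ , _) = cong lamₙ (reify-Eq B (F S_ (reflect-Eq A (neu Z ε))))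

  reflect-Eq : ∀ {Γ} A (n : Ne Γ A) → Eq A (reflect A n) (reflect A n)
  reflect-Eq ι       n = ≡.refl
  reflect-Eq (A ⇒ B) n = (λ ρ e → reflect-≡ B (cong (appNe _) (reify-Eq A e))) , U , U
    where
    U : Uniform A B (reflect (A ⇒ B) n)
    U ρ ρ′ {u} e = Eq-trans B (renameVal-reflect B ρ′ _) (reflect-≡ B (≡.trans
      (renameNe-appNe ρ′ (renameNe ρ n) (reify A u))
      (cong₂ appNe (renameNe-∘ ρ′ ρ n) (reify-renameVal A ρ′ e))))

  reflect-≡ : ∀ {Γ} A {m m′ : Ne Γ A} → m ≡ m′ → Eq A (reflect A m) (reflect A m′)
  reflect-≡ A {m} ≡.refl = reflect-Eq A m

  renameVal-reflect : ∀ {Γ Δ} A (ρ : Ren Γ Δ) (n : Ne Γ A) →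
                      Eq A (renameVal A ρ (reflect A n)) (reflect A (renameNe ρ n))
  renameVal-reflect ι       ρ n = ≡.refl
  renameVal-reflect (A ⇒ B) ρ n =
    (λ ρ′ e → reflect-≡ B (cong₂ appNe (≡.sym (renameNe-∘ ρ′ ρ n)) (reify-Eq A e)))
    , uniformˡ A B (Eq-renameVal (A ⇒ B) ρ (reflect-Eq (A ⇒ B) n))
    , uniformˡ A B (reflect-Eq (A ⇒ B) (renameNe ρ n))

  reify-renameVal : ∀ {Γ Δ} A (ρ : Ren Γ Δ) {u : Val Γ A} → Eq A u u →
                    renameNf ρ (reify A u) ≡ reify A (renameVal A ρ u)
  reify-renameVal ι       ρ e            = ≡.refl
  reify-renameVal (A ⇒ B) ρ (F , Uf , _) = cong lamₙ (≡.trans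
    (reify-renameVal B (ext ρ) (F S_ (reflect-Eq A (neu Z ε))))
    (≡.trans (reify-Eq B (Uf S_ (ext ρ) (reflect-Eq A (neu Z ε))))
             (reify-Eq B (F (S_ ∘ ρ) (renameVal-reflect A (ext ρ) (neu Z ε))))))

EqEnv : ∀ {Γ Δ} → Env Γ Δ → Env Γ Δ → Set
EqEnv {Γ} γ γ′ = ∀ {A} (x : Γ ∋ A) → Eq A (γ x) (γ′ x)

EqEnv-sym : ∀ {Γ Δ} {γ γ′ : Env Γ Δ} → EqEnv γ γ′ → EqEnv γ′ γ
EqEnv-sym h {A} x = Eq-sym A (h x)

EqEnv-reflˡ : ∀ {Γ Δ} {γ γ′ : Env Γ Δ} → EqEnv γ γ′ → EqEnv γ γ
EqEnv-reflˡ h {A} x = Eq-reflˡ A (h x)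

EqEnv-reflʳ : ∀ {Γ Δ} {γ γ′ : Env Γ Δ} → EqEnv γ γ′ → EqEnv γ′ γ′
EqEnv-reflʳ h {A} x = Eq-reflʳ A (h x)

EqEnv-extEnv : ∀ {Γ Δ A} {γ γ′ : Env Γ Δ} {u v : Val Δ A} → EqEnv γ γ′ → Eq A u v →
               EqEnv (extEnv γ u) (extEnv γ′ v)
EqEnv-extEnv h e Z     = e
EqEnv-extEnv h e (S x) = h x

EqEnv-renameEnv : ∀ {Γ Δ Θ} (ρ : Ren Δ Θ) {γ γ′ : Env Γ Δ} → EqEnv γ γ′ →
                  EqEnv (renameEnv ρ γ) (renameEnv ρ γ′)
EqEnv-renameEnv ρ h {A} x = Eq-renameVal A ρ (h x)

idEnv-Eq : ∀ {Γ} → EqEnv (idEnv {Γ}) idEnv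
idEnv-Eq {A = A} x = reflect-Eq A (neu x ε)

mutual
  eval-Eq : ∀ {Γ Δ A} (M : Tm Γ A) {γ γ′ : Env Γ Δ} → EqEnv γ γ′ → Eq A (eval M γ) (eval M γ′)
  eval-Eq (var x)   h = h x
  eval-Eq (app M N) h = proj₁ (eval-Eq M h) id (eval-Eq N h)
  eval-Eq (lam M)   h = (λ ρ e → eval-Eq M (EqEnv-extEnv (EqEnv-renameEnv ρ h) e))
                        , eval-lam-uniform M (EqEnv-reflˡ h) , eval-lam-uniform M (EqEnv-reflʳ h)

  eval-lam-uniform : ∀ {Γ Δ A B} (M : Tm (A ∷ Γ) B) {γ : Env Γ Δ} → EqEnv γ γ →
                     Uniform A B (eval (lam M) γ)
  eval-lam-uniform {A = A} {B} M {γ} h ρ ρ′ {u} e =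
    Eq-trans B (eval-renameVal M ρ′ (EqEnv-extEnv (EqEnv-renameEnv ρ h) e)) (eval-Eq M h′)
    where
    h′ : EqEnv (renameEnv ρ′ (extEnv (renameEnv ρ γ) u)) (extEnv (renameEnv (ρ′ ∘ ρ) γ) (renameVal A ρ′ u))
    h′ Z         = Eq-renameVal A ρ′ e
    h′ {C} (S x) = renameVal-∘ C ρ′ ρ (h x)

  eval-renameVal : ∀ {Γ Δ Θ A} (M : Tm Γ A) (ρ : Ren Δ Θ) {γ γ′ : Env Γ Δ} → EqEnv γ γ′ →
                   Eq A (renameVal A ρ (eval M γ)) (eval M (renameEnv ρ γ′))
  eval-renameVal (var x) ρ h = EqEnv-renameEnv ρ h x
  eval-renameVal {A = B} (app {A} M N) ρ h =
    Eq-trans B (uniformˡ A B (eval-Eq M (EqEnv-reflˡ h)) id ρ (eval-Eq N (EqEnv-reflˡ h)))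
               (proj₁ (eval-renameVal M ρ h) id (eval-renameVal N ρ h))
  eval-renameVal (lam {A} {B} M) ρ {γ} {γ′} h =
    (λ ρ′ e → eval-Eq M (EqEnv-extEnv (h′ ρ′) e))
    , uniformˡ A B (Eq-renameVal (A ⇒ B) ρ (eval-Eq (lam M) (EqEnv-reflˡ h)))
    , uniformˡ A B (eval-Eq (lam M) (EqEnv-renameEnv ρ (EqEnv-reflʳ h)))
    where
    h′ : ∀ {Δ′} (ρ′ : Ren _ Δ′) → EqEnv (renameEnv (ρ′ ∘ ρ) γ) (renameEnv ρ′ (renameEnv ρ γ′))
    h′ ρ′ {C} x = Eq-trans C (Eq-renameVal C _ (h x)) (Eq-sym C (renameVal-∘ C ρ′ ρ (Eq-reflʳ C (h x))))

eval-rename : ∀ {Γ Γ′ Δ A} (M : Tm Γ A) (r : Ren Γ Γ′) {γ γ′ : Env Γ′ Δ} → EqEnv γ γ′ →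
              Eq A (eval (rename r M) γ) (eval M (γ′ ∘ r))
eval-rename (var x)   r h = h (r x)
eval-rename (app M N) r h = proj₁ (eval-rename M r h) id (eval-rename N r h)
eval-rename {A = A ⇒ B} (lam M) r h =
  (λ ρ e → Eq-trans B (eval-rename M (ext r) (EqEnv-extEnv (EqEnv-renameEnv ρ h) e))
                      (eval-Eq M (λ { Z → Eq-reflʳ A e ; {C} (S x) → Eq-reflʳ C (Eq-renameVal C ρ (h (r x))) })))
  , uniformˡ A B (eval-Eq (lam (rename (ext r) M)) (EqEnv-reflˡ h))
  , uniformˡ A B (eval-Eq (lam M) (EqEnv-reflʳ h ∘ r))

eval-sub : ∀ {Γ Γ′ Δ A} (M : Tm Γ A) (σ : Sub Γ Γ′) {γ γ′ : Env Γ′ Δ} → EqEnv γ γ′ →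
           Eq A (eval (sub σ M) γ) (eval M (λ x → eval (σ x) γ′))
eval-sub (var x)   σ h = eval-Eq (σ x) h
eval-sub (app M N) σ h = proj₁ (eval-sub M σ h) id (eval-sub N σ h)
eval-sub {A = A ⇒ B} (lam M) σ {γ′ = γ′} h =
  (λ ρ e → Eq-trans B (eval-sub M (exts σ) (EqEnv-extEnv (EqEnv-renameEnv ρ h) e)) (eval-Eq M (h′ ρ e)))
  , uniformˡ A B (eval-Eq (lam (sub (exts σ) M)) (EqEnv-reflˡ h))
  , uniformˡ A B (eval-Eq (lam M) (λ x → eval-Eq (σ x) (EqEnv-reflʳ h)))
  where
  h′ : ∀ {Δ′} (ρ : Ren _ Δ′) {u v : Val Δ′ A} → Eq A u v →
       EqEnv (λ x → eval (exts σ x) (extEnv (renameEnv ρ γ′) v)) (extEnv (renameEnv ρ (λ x → eval (σ x) γ′)) v)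
  h′ ρ e Z         = Eq-reflʳ A e
  h′ ρ e {C} (S x) =
    Eq-trans C (eval-rename (σ x) S_ (EqEnv-extEnv (EqEnv-renameEnv ρ (EqEnv-reflʳ h)) (Eq-reflʳ A e)))
               (Eq-sym C (eval-renameVal (σ x) ρ (EqEnv-reflʳ h)))

eval-=βη : ∀ {Γ Δ A} {M N : Tm Γ A} → M =βη N → {γ γ′ : Env Γ Δ} → EqEnv γ γ′ →
           Eq A (eval M γ) (eval N γ′)
eval-=βη {A = B} (β {A} M N) {γ} {γ′} h =
  Eq-trans B (eval-Eq M h′) (Eq-sym B (eval-sub M (sub₀ N) (EqEnv-reflʳ h)))
  where
  h′ : EqEnv (extEnv (renameEnv id γ) (eval N γ)) (λ x → eval (sub₀ N x) γ′)
  h′ Z         = eval-Eq N h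
  h′ {C} (S x) = Eq-trans C (renameVal-id C (Eq-reflˡ C (h x))) (h x)
eval-=βη (η {A} {B} M) h =
  (λ ρ e → Eq-trans B (proj₁ (eval-renameVal M ρ h) id e)
    (Eq-sym B (proj₁ (eval-rename M S_ (EqEnv-extEnv (EqEnv-renameEnv ρ (EqEnv-reflʳ h)) (Eq-reflʳ A e)))
                     id (Eq-reflʳ A e))))
  , uniformˡ A B (eval-Eq M (EqEnv-reflˡ h))
  , uniformˡ A B (eval-Eq (lam (app (rename S_ M) (var Z))) (EqEnv-reflʳ h))
eval-=βη (ξ-lam {A} {B} {M} {M′} p) h =
  (λ ρ e → eval-=βη p (EqEnv-extEnv (EqEnv-renameEnv ρ h) e))
  , uniformˡ A B (eval-Eq (lam M) (EqEnv-reflˡ h))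
  , uniformˡ A B (eval-Eq (lam M′) (EqEnv-reflʳ h))
eval-=βη (ξ-app p q)         h = proj₁ (eval-=βη p h) id (eval-=βη q h)
eval-=βη {M = M} refl         h = eval-Eq M h
eval-=βη {A = A} (sym p)     h = Eq-sym A (eval-=βη p (EqEnv-sym h))
eval-=βη {A = A} (trans p q) h = Eq-trans A (eval-=βη p h) (eval-=βη q (EqEnv-reflʳ h))

nf-complete : ∀ {Γ A} {M N : Tm Γ A} → M =βη N → nf M ≡ nf N
nf-complete {A = A} p = reify-Eq A (eval-=βη p idEnv-Eq)

-- The Kripke logical relation "M is βη-equal to the term read back from v".
Rel : ∀ {Γ} A → Tm Γ A → Val Γ A → Set
Rel ι       M n = M =βη ⌜ n ⌝
Rel (A ⇒ B) M f = ∀ {Δ} (ρ : Ren _ Δ) {N v} → Rel A N v → Rel B (app (rename ρ M) N) (f ρ v)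

Rel-=βη : ∀ {Γ} A {M M′ : Tm Γ A} {v} → M =βη M′ → Rel A M v → Rel A M′ v
Rel-=βη ι       p r      = trans (sym p) r
Rel-=βη (A ⇒ B) p r ρ rv = Rel-=βη B (ξ-app (rename-=βη ρ p) refl) (r ρ rv)

Rel-rename : ∀ {Γ Δ} A (ρ : Ren Γ Δ) {M v} → Rel A M v → Rel A (rename ρ M) (renameVal A ρ v)
Rel-rename ι       ρ {v = v} r = trans (rename-=βη ρ r) (≡⇒=βη (≡.sym (⌜⌝-rename ρ v)))
Rel-rename (A ⇒ B) ρ {M} r ρ′ rv =
  Rel-=βη B (ξ-app (≡⇒=βη (≡.sym (rename-∘ ρ′ ρ M))) refl) (r (ρ′ ∘ ρ) rv)

mutual
  reify-sound : ∀ {Γ} A {M : Tm Γ A} {v} → Rel A M v → M =βη ⌜ reify A v ⌝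
  reify-sound ι       r = r
  reify-sound (A ⇒ B) {M} r =
    trans (η M) (ξ-lam (reify-sound B (r S_ (reflect-sound A (neu Z ε) refl))))

  reflect-sound : ∀ {Γ} A (n : Ne Γ A) {M} → M =βη ⌜ n ⌝ⁿᵉ → Rel A M (reflect A n)
  reflect-sound ι       n p = p
  reflect-sound (A ⇒ B) n p ρ {v = v} rv = reflect-sound B _
    (trans (ξ-app (trans (rename-=βη ρ p) (≡⇒=βη (≡.sym (⌜⌝ⁿᵉ-rename ρ n)))) (reify-sound A rv))
           (≡⇒=βη (≡.sym (⌜appNe⌝ (renameNe ρ n) (reify A v)))))

eval-sound : ∀ {Γ Δ A} (M : Tm Γ A) (σ : Sub Γ Δ) (γ : Env Γ Δ) →
             (∀ {C} (x : Γ ∋ C) → Rel C (σ x) (γ x)) → Rel A (sub σ M) (eval M γ)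
eval-sound (var x) σ γ h = h x
eval-sound {A = B} (app M N) σ γ h =
  ≡.subst (λ t → Rel B (app t (sub σ N)) (eval (app M N) γ)) (rename-id (sub σ M))
    (eval-sound M σ γ h id (eval-sound N σ γ h))
eval-sound {A = A ⇒ B} (lam M) σ γ h ρ {N} rv =
  Rel-=βη B (sym (trans (β _ N) (≡⇒=βη β-result)))
    (eval-sound M (N ▸ rename ρ ∘ σ) _ (λ { Z → rv ; {C} (S x) → Rel-rename C ρ (h x) }))
  where
  β-result : rename (ext ρ) (sub (exts σ) M) [ N ]₀ ≡ sub (N ▸ rename ρ ∘ σ) M
  β-result = ≡.trans (sub-rename (sub₀ N) (ext ρ) (sub (exts σ) M))
                     (≡.trans (sub-∘ _ (exts σ) M) (sub-cong pointwise M))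
    where
    pointwise : sub (sub₀ N ∘ ext ρ) ∘ exts σ ≗ˢ N ▸ rename ρ ∘ σ
    pointwise Z     = ≡.refl
    pointwise (S x) = ≡.trans (sub-rename _ S_ (σ x)) (≡.sym (rename≗sub ρ (σ x)))

nf-sound : ∀ {Γ A} (M : Tm Γ A) → M =βη ⌜ nf M ⌝
nf-sound {A = A} M = reify-sound A (≡.subst (λ t → Rel A t (eval M idEnv)) (sub-var M)
  (eval-sound M var idEnv (λ {C} x → reflect-sound C (neu x ε) refl)))

≡-nf⇒=βη : ∀ {Γ A} {M N : Tm Γ A} → nf M ≡ nf N → M =βη N
≡-nf⇒=βη {M = M} {N} e = trans (nf-sound M) (trans (≡⇒=βη (cong ⌜_⌝ e)) (sym (nf-sound N)))

nfArgs : ∀ {Γ A C} → NeSpine Γ A C → Spine Γ C → NeSpine Γ A ι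
nfArgs sp []       = sp
nfArgs sp (M ∷ Ms) = nfArgs (sp ▷ nf M) Ms

▷-injective : ∀ {Γ A B C} {p q : NeSpine Γ A (B ⇒ C)} {m n : Nf Γ B} → p ▷ m ≡ q ▷ n → p ≡ q × m ≡ n
▷-injective ≡.refl = ≡.refl , ≡.refl

nfArgs-injective : ∀ {Γ A C} {p q : NeSpine Γ A C} (Ms Ns : Spine Γ C) →
                   nfArgs p Ms ≡ nfArgs q Ns → p ≡ q × Ms ≈ₛ Ns
nfArgs-injective []       []       e = e , []
nfArgs-injective (M ∷ Ms) (N ∷ Ns) e with nfArgs-injective Ms Ns e
... | p▷m≡q▷n , Ms≈Ns with ▷-injective p▷m≡q▷n
...   | p≡q , m≡n = p≡q , (≡-nf⇒=βη m≡n ∷ Ms≈Ns)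

eval-apps : ∀ {Γ A C} (M : Tm Γ C) (a : Γ ∋ A) (sp : NeSpine Γ A C) →
            Eq C (eval M idEnv) (reflect C (neu a sp)) → (Ms : Spine Γ C) →
            eval (apps M Ms) idEnv ≡ neₙ (neu a (nfArgs sp Ms))
eval-apps M a sp e []                   = e
eval-apps {C = A ⇒ B} M a sp e (N ∷ Ms) = eval-apps (app M N) a (sp ▷ nf N)
  (≡.subst (λ s → Eq B (eval (app M N) idEnv) (reflect B (neu a (s ▷ nf N))))
           (renameNeSpine-id sp) (proj₁ e id (eval-Eq N idEnv-Eq))) Ms

nf-apps-var : ∀ {Γ A} (a : Γ ∋ A) (Ms : Spine Γ A) → nf (apps (var a) Ms) ≡ neₙ (neu a (nfArgs ε Ms))
nf-apps-var {A = A} a = eval-apps (var a) a ε (reflect-Eq A (neu a ε))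

apps-var-injective : ∀ {Γ A B} (a : Γ ∋ A) (b : Γ ∋ B) (Ms : Spine Γ A) (Ns : Spine Γ B) →
                     apps (var a) Ms =βη apps (var b) Ns → SameHeadArgs a b Ms Ns
apps-var-injective a b Ms Ns p =
  neₙ-injective (≡.trans (≡.sym (nf-apps-var a Ms)) (≡.trans (nf-complete p) (nf-apps-var b Ns))) ≡.refl ≡.refl
  where
  neₙ-injective : ∀ {s t} → neₙ (neu a s) ≡ neₙ (neu b t) → s ≡ nfArgs ε Ms → t ≡ nfArgs ε Ns →
                  SameHeadArgs a b Ms Ns
  neₙ-injective ≡.refl s≡ t≡ = same (proj₂ (nfArgs-injective Ms Ns (≡.trans (≡.sym s≡) t≡)))

infixl 4.5 _,*_
_,*_ : Ctx → List Ty → Ctx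
Γ ,* []       = Γ
Γ ,* (C ∷ Cs) = C ∷ Γ ,* Cs

lam* : ∀ {Γ} (Cs : List Ty) → Tm (Γ ,* Cs) ι → Tm Γ [ Cs ]
lam* []       b = b
lam* (C ∷ Cs) b = lam (lam* Cs b)

weaken* : ∀ {Γ A} (Cs : List Ty) → Γ ∋ A → Γ ,* Cs ∋ A
weaken* []       x = x
weaken* (C ∷ Cs) x = weaken* Cs (S x)

extend* : ∀ {Γ Δ} (Cs : List Ty) → Sub Γ Δ → Spine Δ [ Cs ] → Sub (Γ ,* Cs) Δ
extend* []       σ []       = σ
extend* (C ∷ Cs) σ (M ∷ Ms) = extend* Cs (M ▸ σ) Ms

extend*-weaken* : ∀ {Γ Δ A} (Cs : List Ty) (σ : Sub Γ Δ) (Ms : Spine Δ [ Cs ]) (x : Γ ∋ A) →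
                  extend* Cs σ Ms (weaken* Cs x) ≡ σ x
extend*-weaken* []       σ []       x = ≡.refl
extend*-weaken* (C ∷ Cs) σ (M ∷ Ms) x = extend*-weaken* Cs (M ▸ σ) Ms (S x)

β* : ∀ {Γ Δ} (Cs : List Ty) (σ : Sub Γ Δ) (b : Tm (Γ ,* Cs) ι) (Ms : Spine Δ [ Cs ]) →
     apps (sub σ (lam* Cs b)) Ms =βη sub (extend* Cs σ Ms) b
β* []       σ b []       = refl
β* (C ∷ Cs) σ b (M ∷ Ms) =
  trans (apps-congˡ Ms (trans (β _ M) (≡⇒=βη (≡.trans (sub-∘ (sub₀ M) (exts σ) (lam* Cs b))
                                                      (sub-cong sub₀-exts (lam* Cs b))))))
        (β* Cs (M ▸ σ) b Ms)
  where
  sub₀-exts : sub (sub₀ M) ∘ exts σ ≗ˢ M ▸ σ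
  sub₀-exts Z     = ≡.refl
  sub₀-exts (S x) = ≡.trans (sub-rename (sub₀ M) S_ (σ x)) (sub-var (σ x))

subSpine : ∀ {Γ Δ A} → Sub Γ Δ → Spine Γ A → Spine Δ A
subSpine σ []       = []
subSpine σ (M ∷ Ms) = sub σ M ∷ subSpine σ Ms

sub-apps : ∀ {Γ Δ A} (σ : Sub Γ Δ) (M : Tm Γ A) (Ms : Spine Γ A) →
           sub σ (apps M Ms) ≡ apps (sub σ M) (subSpine σ Ms)
sub-apps σ M []       = ≡.refl
sub-apps σ M (N ∷ Ms) = sub-apps σ (app M N) Ms

bound : ∀ {Γ} (k : ℕ) (C : Fin k → Ty) (j : Fin k) → Γ ,* tabulate C ∋ C j
bound (suc k) C zero    = weaken* (tabulate (C ∘ suc)) Z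
bound (suc k) C (suc j) = bound k (C ∘ suc) j

argAt : ∀ {Γ} (k : ℕ) (C : Fin k → Ty) → Spine Γ [ tabulate C ] → (j : Fin k) → Tm Γ (C j)
argAt (suc k) C (M ∷ Ms) zero    = M
argAt (suc k) C (M ∷ Ms) (suc j) = argAt k (C ∘ suc) Ms j

spineOf : ∀ {Γ} (k : ℕ) (C : Fin k → Ty) → ((j : Fin k) → Tm Γ (C j)) → Spine Γ [ tabulate C ]
spineOf zero    C f = []
spineOf (suc k) C f = f zero ∷ spineOf k (C ∘ suc) (f ∘ suc)

extend*-bound : ∀ {Γ Δ} (k : ℕ) (C : Fin k → Ty) (σ : Sub Γ Δ) (Ms : Spine Δ [ tabulate C ]) (j : Fin k) →
                extend* (tabulate C) σ Ms (bound k C j) ≡ argAt k C Ms j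
extend*-bound (suc k) C σ (M ∷ Ms) zero    = extend*-weaken* (tabulate (C ∘ suc)) (M ▸ σ) Ms Z
extend*-bound (suc k) C σ (M ∷ Ms) (suc j) = extend*-bound k (C ∘ suc) (M ▸ σ) Ms j

subSpine-spineOf : ∀ {Γ Δ} (k : ℕ) (C : Fin k → Ty) (σ : Sub Γ Δ) (f : (j : Fin k) → Tm Γ (C j)) →
                   subSpine σ (spineOf k C f) ≡ spineOf k C (sub σ ∘ f)
subSpine-spineOf zero    C σ f = ≡.refl
subSpine-spineOf (suc k) C σ f = cong (sub σ (f zero) ∷_) (subSpine-spineOf k (C ∘ suc) σ (f ∘ suc))

spineOf-cong : ∀ {Γ} (k : ℕ) (C : Fin k → Ty) {f g : (j : Fin k) → Tm Γ (C j)} →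
               (∀ j → f j ≡ g j) → spineOf k C f ≡ spineOf k C g
spineOf-cong zero    C h = ≡.refl
spineOf-cong (suc k) C h = cong₂ _∷_ (h zero) (spineOf-cong k (C ∘ suc) (h ∘ suc))

argAt-spineOf : ∀ {Γ} (k : ℕ) (C : Fin k → Ty) (f : (j : Fin k) → Tm Γ (C j)) (j : Fin k) →
                argAt k C (spineOf k C f) j ≡ f j
argAt-spineOf (suc k) C f zero    = ≡.refl
argAt-spineOf (suc k) C f (suc j) = argAt-spineOf k (C ∘ suc) (f ∘ suc) j

≈ₛ-argAt : ∀ {Γ} (k : ℕ) (C : Fin k → Ty) {Ms Ns : Spine Γ [ tabulate C ]} →
           Ms ≈ₛ Ns → ∀ j → argAt k C Ms j =βη argAt k C Ns j
≈ₛ-argAt (suc k) C (p ∷ ps) zero    = p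
≈ₛ-argAt (suc k) C (p ∷ ps) (suc j) = ≈ₛ-argAt k (C ∘ suc) ps j

argAt-≈ₛ : ∀ {Γ} (k : ℕ) (C : Fin k → Ty) (Ms Ns : Spine Γ [ tabulate C ]) →
           (∀ j → argAt k C Ms j =βη argAt k C Ns j) → Ms ≈ₛ Ns
argAt-≈ₛ zero    C []       []       h = []
argAt-≈ₛ (suc k) C (M ∷ Ms) (N ∷ Ns) h = h zero ∷ argAt-≈ₛ k (C ∘ suc) Ms Ns (h ∘ suc)

embedˡ : ∀ {Ξ Γ A} → Ξ ∋ A → Ξ ++ Γ ∋ A
embedˡ Z     = Z
embedˡ (S x) = S (embedˡ x)

embedʳ : ∀ {Γ A} (Ξ : Ctx) → Γ ∋ A → Ξ ++ Γ ∋ A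
embedʳ []      x = x
embedʳ (B ∷ Ξ) x = S (embedʳ Ξ x)

data Split (Ξ : Ctx) {Γ : Ctx} {A : Ty} : Ξ ++ Γ ∋ A → Set where
  inˡ : (x : Ξ ∋ A) → Split Ξ (embedˡ x)
  inʳ : (x : Γ ∋ A) → Split Ξ (embedʳ Ξ x)

split : ∀ {Γ A} (Ξ : Ctx) (a : Ξ ++ Γ ∋ A) → Split Ξ a
split []      a     = inʳ a
split (B ∷ Ξ) Z     = inˡ Z
split (B ∷ Ξ) (S a) with split Ξ a
... | inˡ x = inˡ (S x)
... | inʳ x = inʳ x

lift-embedˡ : ∀ {Γ Δ A} (Ξ : Ctx) (ϱ : Sub Γ Δ) (x : Ξ ∋ A) → lift Ξ ϱ (embedˡ x) ≡ var (embedˡ x)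
lift-embedˡ (B ∷ Ξ) ϱ Z     = ≡.refl
lift-embedˡ (B ∷ Ξ) ϱ (S x) = cong (rename S_) (lift-embedˡ Ξ ϱ x)

lift-embedʳ : ∀ {Γ Δ A} (Ξ : Ctx) (ϱ : Sub Γ Δ) (x : Γ ∋ A) →
              lift Ξ ϱ (embedʳ Ξ x) ≡ sub (var ∘ embedʳ Ξ) (ϱ x)
lift-embedʳ []      ϱ x = ≡.sym (sub-var (ϱ x))
lift-embedʳ (B ∷ Ξ) ϱ x = ≡.trans (cong (rename S_) (lift-embedʳ Ξ ϱ x)) (rename-sub S_ _ (ϱ x))

module _ {Θ Φ : Ctx} {C A B : Ty} {u : Θ ∋ A} {v : Θ ∋ B} {Ms : Spine Φ A} {Ns : Spine Φ B} where

  SameHeadArgs-S : SameHeadArgs u v Ms Ns → SameHeadArgs {C ∷ Θ} (S u) (S v) Ms Ns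
  SameHeadArgs-S (same p) = same p

  SameHeadArgs-S⁻ : SameHeadArgs {C ∷ Θ} (S u) (S v) Ms Ns → SameHeadArgs u v Ms Ns
  SameHeadArgs-S⁻ (same p) = same p

SameHeadArgs-embedˡ : ∀ {Ξ Γ Δ Φ A B} (x : Ξ ∋ A) (y : Ξ ∋ B) {Ms : Spine Φ A} {Ns : Spine Φ B} →
                      SameHeadArgs {Ξ ++ Δ} (embedˡ x) (embedˡ y) Ms Ns →
                      SameHeadArgs {Ξ ++ Γ} (embedˡ x) (embedˡ y) Ms Ns
SameHeadArgs-embedˡ Z     Z     (same p) = same p
SameHeadArgs-embedˡ Z     (S y) ()
SameHeadArgs-embedˡ (S x) Z     ()
SameHeadArgs-embedˡ {Γ = Γ} {Δ} (S x) (S y) s =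
  SameHeadArgs-S (SameHeadArgs-embedˡ {Γ = Γ} {Δ} x y (SameHeadArgs-S⁻ s))

¬SameHeadArgs-embedˡ-embedʳ : ∀ {Ξ Δ Φ A B} (x : Ξ ∋ A) (y : Δ ∋ B) {Ms : Spine Φ A} {Ns : Spine Φ B} →
                              ¬ SameHeadArgs {Ξ ++ Δ} (embedˡ x) (embedʳ Ξ y) Ms Ns
¬SameHeadArgs-embedˡ-embedʳ Z     y ()
¬SameHeadArgs-embedˡ-embedʳ (S x) y s = ¬SameHeadArgs-embedˡ-embedʳ x y (SameHeadArgs-S⁻ s)

single : ∀ {Δ T} → Tm Δ T → Sub (T ∷ []) Δ
single t Z = t

single-atomic : ∀ {T T′} (t : Tm (T′ ∷ []) T) (f : ∀ {Θ} → Spine Θ T → Spine Θ T′) →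
                (∀ {Θ} (σ : Sub (T′ ∷ []) Θ) (Ms : Spine Θ T) → apps (sub σ t) Ms =βη apps (σ Z) (f Ms)) →
                (∀ {Θ} {Ms Ns : Spine Θ T} → f Ms ≈ₛ f Ns → Ms ≈ₛ Ns) →
                IsAtomicReduction (single t)
single-atomic {T} {T′} t f t-β f-injective Ξ a b = atomic (split Ξ a) (split Ξ b)
  where
  Θ = Ξ ++ T′ ∷ []

  unfoldˡ : ∀ {A} (x : Ξ ∋ A) (Ms : Spine Θ A) →
            apps (lift Ξ (single t) (embedˡ x)) Ms =βη apps (var (embedˡ x)) Ms
  unfoldˡ x Ms = ≡⇒=βη (cong (λ h → apps h Ms) (lift-embedˡ Ξ (single t) x))

  unfoldʳ : (Ms : Spine Θ T) → apps (lift Ξ (single t) (embedʳ Ξ Z)) Ms =βη apps (var (embedʳ Ξ Z)) (f Ms)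
  unfoldʳ Ms = trans (≡⇒=βη (cong (λ h → apps h Ms) (lift-embedʳ Ξ (single t) Z))) (t-β _ Ms)

  atomic : ∀ {A B} {a : Ξ ++ T ∷ [] ∋ A} {b : Ξ ++ T ∷ [] ∋ B} → Split Ξ a → Split Ξ b →
           (Ms : Spine Θ A) (Ns : Spine Θ B) →
           apps (lift Ξ (single t) a) Ms =βη apps (lift Ξ (single t) b) Ns → SameHeadArgs a b Ms Ns
  atomic (inˡ x) (inˡ y) Ms Ns p = SameHeadArgs-embedˡ {Δ = T′ ∷ []} x y
    (apps-var-injective _ _ Ms Ns (trans (sym (unfoldˡ x Ms)) (trans p (unfoldˡ y Ns))))
  atomic (inˡ x) (inʳ Z) Ms Ns p = ⊥-elim (¬SameHeadArgs-embedˡ-embedʳ x Z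
    (apps-var-injective _ _ Ms (f Ns) (trans (sym (unfoldˡ x Ms)) (trans p (unfoldʳ Ns)))))
  atomic (inʳ Z) (inˡ y) Ms Ns p = ⊥-elim (¬SameHeadArgs-embedˡ-embedʳ y Z
    (apps-var-injective _ _ Ns (f Ms) (trans (sym (unfoldˡ y Ns)) (trans (sym p) (unfoldʳ Ms)))))
  atomic (inʳ Z) (inʳ Z) Ms Ns p with apps-var-injective _ _ (f Ms) (f Ns)
                                         (trans (sym (unfoldʳ Ms)) (trans p (unfoldʳ Ns)))
  ... | same fMs≈fNs = same (f-injective fMs≈fNs)

module Permute (k : ℕ) (C : Fin k → Ty) (φ : Permutation′ k) where

  Cφ : Fin k → Ty
  Cφ = C ∘ (φ ⟨$⟩ʳ_)

  permuteSpine : ∀ {Θ} → Spine Θ [ tabulate C ] → Spine Θ [ tabulate Cφ ]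
  permuteSpine Ms = spineOf k Cφ (argAt k C Ms ∘ (φ ⟨$⟩ʳ_))

  permutedBound : Spine ([ tabulate Cφ ] ∷ [] ,* tabulate C) [ tabulate Cφ ]
  permutedBound = spineOf k Cφ (var ∘ bound k C ∘ (φ ⟨$⟩ʳ_))

  permutedCall : Tm ([ tabulate Cφ ] ∷ [] ,* tabulate C) ι
  permutedCall = apps (var (weaken* (tabulate C) Z)) permutedBound

  permute : Tm ([ tabulate Cφ ] ∷ []) [ tabulate C ]
  permute = lam* (tabulate C) permutedCall

  permute-β : ∀ {Θ} (σ : Sub ([ tabulate Cφ ] ∷ []) Θ) (Ms : Spine Θ [ tabulate C ]) →
              apps (sub σ permute) Ms =βη apps (σ Z) (permuteSpine Ms)
  permute-β σ Ms = trans (β* (tabulate C) σ permutedCall Ms) (≡⇒=βη (begin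
      sub σ′ permutedCall
    ≡⟨ sub-apps σ′ (var (weaken* (tabulate C) Z)) permutedBound ⟩
      apps (σ′ (weaken* (tabulate C) Z)) (subSpine σ′ permutedBound)
    ≡⟨ cong₂ apps (extend*-weaken* (tabulate C) σ Ms Z) (subSpine-spineOf k Cφ σ′ _) ⟩
      apps (σ Z) (spineOf k Cφ (σ′ ∘ bound k C ∘ (φ ⟨$⟩ʳ_)))
    ≡⟨ cong (apps (σ Z)) (spineOf-cong k Cφ (extend*-bound k C σ Ms ∘ (φ ⟨$⟩ʳ_))) ⟩
      apps (σ Z) (permuteSpine Ms)
    ∎))
    where
    open ≡.≡-Reasoning
    σ′ = extend* (tabulate C) σ Ms

  permuteSpine-injective : ∀ {Θ} {Ms Ns : Spine Θ [ tabulate C ]} →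
                           permuteSpine Ms ≈ₛ permuteSpine Ns → Ms ≈ₛ Ns
  permuteSpine-injective {Ms = Ms} {Ns} p = argAt-≈ₛ k C Ms Ns λ j →
    ≡.subst (λ i → argAt k C Ms i =βη argAt k C Ns i) (inverseʳ φ) (at (φ ⟨$⟩ˡ j))
    where
    at : ∀ i → argAt k C Ms (φ ⟨$⟩ʳ i) =βη argAt k C Ns (φ ⟨$⟩ʳ i)
    at i = trans (≡⇒=βη (≡.sym (argAt-spineOf k Cφ _ i)))
                 (trans (≈ₛ-argAt k Cφ p i) (≡⇒=βη (argAt-spineOf k Cφ _ i)))

lemmaL : (k : ℕ) (C : Fin k → Ty) (φ : Permutation′ k) →
         [ [ tabulate C ] ∷ [] ] ≤ᵃ [ [ tabulate (λ i → C (φ ⟨$⟩ʳ i)) ] ∷ [] ]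
lemmaL k C φ = single permute , single-atomic permute permuteSpine permute-β permuteSpine-injective
  where open Permute k C φ
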